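{- For all integers $t\ge2$ and $1\le l\le t-1$, the Turán graph $T(2t-l-1,l)$ does not contain $K_t$ as a minor.
   Context: For integers $N\ge\omega\ge1$, the Turán graph $T(N,\omega)$ is the complete $\omega$-partite graph on $N$ vertices with part sizes $\lfloor N/\omega\rfloor$ or $\lceil N/\omega\rceil$. -}

module Defs where

open import Data.Nat using (ℕ; NonZero; _%_)
open import Data.Fin using (Fin; toℕ)
open import Data.Product using (Σ; _×_; ∃; ∃-syntax)
open import Relation.Binary.PropositionalEquality using (_≡_)
open import Relation.Nullary using (¬_)

record Graph (n : ℕ) : Set₁ where
  field
    Adj   : Fin n → Fin n → Set
    sym   : ∀ {u v} → Adj u v → Adj v u
    irrefl : ∀ {u} → ¬ Adj u u
open Graph public

-- Turán graph T(N, ω): vertex i lies in part (i mod ω); two vertices are adjacent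
-- iff they lie in different parts.  Parts have sizes ⌊N/ω⌋ or ⌈N/ω⌉.
Turan : (N ω : ℕ) → .{{NonZero ω}} → Graph N
Turan N ω = record
  { Adj = λ i j → ¬ (toℕ i % ω ≡ toℕ j % ω)
  ; sym = λ ne eq → ne (Relation.Binary.PropositionalEquality.sym eq)
  ; irrefl = λ ne → ne Relation.Binary.PropositionalEquality.refl
  }

-- Walks inside a vertex set P (P a predicate on vertices): Reach G P u v means
-- there is a walk from u to v in G all of whose vertices satisfy P (assuming P u).
data Reach {n : ℕ} (G : Graph n) (P : Fin n → Set) : Fin n → Fin n → Set where
  here : ∀ {u} → Reach G P u u
  step : ∀ {u w v} → Adj G u w → P w → Reach G P w v → Reach G P u v

record KMinorModel {n : ℕ} (G : Graph n) (t : ℕ) : Set₁ where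
  field
    inBranch  : Fin n → Fin t → Set
    disjoint  : ∀ v {a b} → inBranch v a → inBranch v b → a ≡ b
    nonempty  : ∀ a → ∃[ v ] inBranch v a
    connected : ∀ a {u v} → inBranch u a → inBranch v a →
                Reach G (λ w → inBranch w a) u v
    adjacent  : ∀ a b → ¬ (a ≡ b) →
                ∃[ u ] ∃[ v ] (inBranch u a × inBranch v b × Adj G u v)

HasKMinor : {n : ℕ} → Graph n → ℕ → Set₁
HasKMinor G t = KMinorModel G t

-- Pick a root vertex in every branch set of a K_t minor model.  A branch set
-- with at least two vertices also owns a second vertex; a singleton branch set
-- is adjacent to every other singleton, so in a proper l-colouring distinct
-- singletons get distinct colours.  Roots, second vertices and singleton
-- colours are thus 2t distinct items among the n vertices and l colours, so
-- 2t ≤ n + l.  The Turán graph T(2t-l-1, l) is properly l-coloured by the part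
-- index and has only 2t-l-1 vertices.
module Submission where

open import Data.Fin using (Fin; toℕ; fromℕ<; splitAt; join; _≟_)
open import Data.Fin.Properties using (toℕ-fromℕ<; injective⇒≤; +↔⊎; ∀-cons)
open import Data.Nat using (ℕ; zero; NonZero; _≤_; _<_; _∸_; _*_; _+_; _%_; suc; s≤s; _≤?_)
open import Data.Nat.DivMod using (m%n<n)
open import Data.Nat.Properties
  using (+-suc; +-comm; +-identityʳ; ∸-+-assoc; m∸n+n≡m; m≤m+n; ≤-reflexive; <-≤-trans; <⇒≱)
open import Data.Product using (_×_; _,_; proj₁; proj₂; ∃-syntax)
open import Data.Sum using (_⊎_; inj₁; inj₂; [_,_])
open import Data.Sum.Properties using (inj₁-injective; inj₂-injective)
open import Function using (_∘_; Injective; Injection)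
open import Function.Construct.Symmetry using (↔-sym)
open import Function.Properties.Inverse using (↔⇒↣)
open import Relation.Nullary using (¬_; Dec; yes; no)
open import Relation.Nullary.Decidable using (decidable-stable; ¬¬-excluded-middle)
open import Relation.Nullary.Negation using (¬¬-map)
open import Relation.Binary.PropositionalEquality
  using (_≡_; _≢_; refl; sym; trans; cong; subst; module ≡-Reasoning)

open import Defs hiding (sym)

¬¬-decidable : ∀ n {P : Fin n → Set} → ¬ ¬ (∀ i → Dec (P i))
¬¬-decidable zero    k = k (λ ())
¬¬-decidable (suc n) k =
  ¬¬-excluded-middle λ d₀ → ¬¬-decidable n λ dₛ → k (∀-cons d₀ dₛ)

⊎-injective⇒≤ : ∀ {a b c d} {f : Fin a ⊎ Fin b → Fin c ⊎ Fin d} →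
                Injective _≡_ _≡_ f → a + b ≤ c + d
⊎-injective⇒≤ {a} {b} {c} {d} {f} f-inj =
  injective⇒≤ {f = join c d ∘ f ∘ splitAt a} (splitAt-injective ∘ f-inj ∘ join-injective)
  where
  splitAt-injective : Injective _≡_ _≡_ (splitAt a {b})
  splitAt-injective = Injection.injective (↔⇒↣ +↔⊎)

  join-injective : Injective _≡_ _≡_ (join c d)
  join-injective = Injection.injective (↔⇒↣ (↔-sym +↔⊎))

m∸n∸1+n<m : ∀ {m n} → n < m → m ∸ n ∸ 1 + n < m
m∸n∸1+n<m {m} {n} n<m = ≤-reflexive (begin
  suc (m ∸ n ∸ 1 + n)  ≡⟨ sym (+-suc (m ∸ n ∸ 1) n) ⟩
  m ∸ n ∸ 1 + suc n    ≡⟨ cong (_+ suc n) (∸-+-assoc m n 1) ⟩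
  m ∸ (n + 1) + suc n  ≡⟨ cong (λ k → m ∸ k + suc n) (+-comm n 1) ⟩
  m ∸ suc n + suc n    ≡⟨ m∸n+n≡m n<m ⟩
  m                    ∎)
  where open ≡-Reasoning

IsProperColouring : ∀ {n l} → Graph n → (Fin n → Fin l) → Set
IsProperColouring G c = ∀ {u v} → Adj G u v → c u ≢ c v

module _ {n l t} {G : Graph n} {c : Fin n → Fin l}
         (c-proper : IsProperColouring G c) (M : KMinorModel G t) where
  open KMinorModel M

  root : Fin t → Fin n
  root a = proj₁ (nonempty a)

  root∈ : ∀ a → inBranch (root a) a
  root∈ a = proj₂ (nonempty a)

  NonSingleton : Fin t → Set
  NonSingleton a = ∃[ v ] inBranch v a × v ≢ root a

  ¬NonSingleton⇒≡root : ∀ {a u} → ¬ NonSingleton a → inBranch u a → u ≡ root a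
  ¬NonSingleton⇒≡root {a} {u} ¬ns u∈a =
    decidable-stable (u ≟ root a) (λ u≢r → ¬ns (u , u∈a , u≢r))

  root-injective : Injective _≡_ _≡_ root
  root-injective {a} {b} eq =
    disjoint (root a) (root∈ a) (subst (λ w → inBranch w b) (sym eq) (root∈ b))

  singleton-colour-injective : ∀ {a b} → ¬ NonSingleton a → ¬ NonSingleton b →
                               c (root a) ≡ c (root b) → a ≡ b
  singleton-colour-injective {a} {b} ¬ns-a ¬ns-b eq = decidable-stable (a ≟ b) λ a≢b →
    let (u , v , u∈a , v∈b , uv) = adjacent a b a≢b in
    c-proper uv (trans (cong c (¬NonSingleton⇒≡root ¬ns-a u∈a))
                (trans eq (sym (cong c (¬NonSingleton⇒≡root ¬ns-b v∈b)))))

  secondOrColour : ∀ a → Dec (NonSingleton a) → Fin n ⊎ Fin l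
  secondOrColour a (yes (v , _)) = inj₁ v
  secondOrColour a (no _)        = inj₂ (c (root a))

  secondOrColour-injective : ∀ {a b} da db → secondOrColour a da ≡ secondOrColour b db → a ≡ b
  secondOrColour-injective {a} {b} (yes (u , u∈a , _)) (yes (v , v∈b , _)) eq =
    disjoint u u∈a (subst (λ w → inBranch w b) (sym (inj₁-injective eq)) v∈b)
  secondOrColour-injective (no ¬ns-a) (no ¬ns-b) eq =
    singleton-colour-injective ¬ns-a ¬ns-b (inj₂-injective eq)

  root≢secondOrColour : ∀ {a b} db → inj₁ (root a) ≢ secondOrColour b db
  root≢secondOrColour {a} (yes (v , v∈b , v≢root)) eq
    with refl ← inj₁-injective eq with refl ← disjoint v (root∈ a) v∈b = v≢root refl

  encode : (∀ a → Dec (NonSingleton a)) → Fin t ⊎ Fin t → Fin n ⊎ Fin l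
  encode d = [ inj₁ ∘ root , (λ a → secondOrColour a (d a)) ]

  encode-injective : ∀ d → Injective _≡_ _≡_ (encode d)
  encode-injective d {inj₁ a} {inj₁ b} eq = cong inj₁ (root-injective (inj₁-injective eq))
  encode-injective d {inj₂ a} {inj₂ b} eq = cong inj₂ (secondOrColour-injective (d a) (d b) eq)
  encode-injective d {inj₁ a} {inj₂ b} eq with () ← root≢secondOrColour (d b) eq
  encode-injective d {inj₂ a} {inj₁ b} eq with () ← root≢secondOrColour (d a) (sym eq)

  -- Being a non-singleton is not decidable, but the conclusion is.
  KMinorModel⇒t+t≤n+l : t + t ≤ n + l
  KMinorModel⇒t+t≤n+l = decidable-stable (t + t ≤? n + l)
    (¬¬-map (λ d → ⊎-injective⇒≤ (encode-injective d)) (¬¬-decidable t))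

turánPart : ∀ {N} l .{{_ : NonZero l}} → Fin N → Fin l
turánPart l v = fromℕ< (m%n<n (toℕ v) l)

turánPart-proper : ∀ N l .{{_ : NonZero l}} → IsProperColouring (Turan N l) (turánPart l)
turánPart-proper N l {u} {v} uv eq = uv (begin
  toℕ u % l              ≡⟨ sym (toℕ-fromℕ< (m%n<n (toℕ u) l)) ⟩
  toℕ (turánPart l u)    ≡⟨ cong toℕ eq ⟩
  toℕ (turánPart l v)    ≡⟨ toℕ-fromℕ< (m%n<n (toℕ v) l) ⟩
  toℕ v % l              ∎)
  where open ≡-Reasoning

lemma3p11 : (t l : ℕ) → 2 ≤ t → .{{_ : NonZero l}} → l ≤ t ∸ 1 →
    ¬ HasKMinor (Turan (2 * t ∸ l ∸ 1) l) t
lemma3p11 (suc t) l (s≤s _) l≤t M = <⇒≱ order+l<2t 2t≤order+l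
  where
  order : ℕ
  order = 2 * suc t ∸ l ∸ 1

  l<2t : l < 2 * suc t
  l<2t = <-≤-trans (s≤s l≤t) (m≤m+n (suc t) (suc t + 0))

  order+l<2t : order + l < 2 * suc t
  order+l<2t = m∸n∸1+n<m l<2t

  2t≤order+l : 2 * suc t ≤ order + l
  2t≤order+l = subst (_≤ order + l) (cong (suc t +_) (sym (+-identityʳ (suc t))))
    (KMinorModel⇒t+t≤n+l (turánPart-proper order l) M)
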